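{- Let $\pi\in\mathsf{G}_{r,n}$ and $a=\text{A-code}(\pi)$. Then for every $0\le t\le r-1$: ${\mathsf{Rmil}}^t(\pi)={\mathsf{Max}}^t(a)$, ${\mathsf{Lmil}}^t(\pi)={\mathsf{Min}}^t(a)$, ${\mathsf{Lmap}}^t(\pi)={\mathsf{Rmil}}^t(a)$ and ${\mathsf{Lmal}}^t(\pi)={\mathsf{Rmip}}^t(a)$ (hence the corresponding colored sets ${\mathsf{Rmil}}(\pi)={\mathsf{Max}}(a)$, ${\mathsf{Lmil}}(\pi)={\mathsf{Min}}(a)$, ${\mathsf{Lmap}}(\pi)={\mathsf{Rmil}}(a)$, ${\mathsf{Lmal}}(\pi)={\mathsf{Rmip}}(a)$ also agree).
   Context: $\Sigma=\{i^{[c]}:1\le i\le n,\ c\in\mathbb{Z}/r\mathbb{Z}\}$, colors $0,\dots,r-1$. $\mathsf{G}_{r,n}$: group under composition of bijections $\pi$ of $\Sigma$ with $\pi(i^{[c]})=\sigma_i^{[z_i+c]}$, $\sigma\in\mathfrak S_n$; window $\pi=\sigma_1^{[z_1]}\cdots\sigma_n^{[z_n]}$. A-code$(\pi)=(c_1^{[e_1]},\dots,c_n^{[e_n]})$ with $c_i=|\{j\le i:\sigma^{ -1}(j)\le\sigma^{ -1}(i)\}|$ and $e_i=z_{\sigma^{ -1}(i)}$. For $\pi$: ${\mathsf{Rmil}}^t(\pi)=\{\sigma_i:z_i=t,\sigma_i<\sigma_j\ \forall j>i\}$; ${\mathsf{Lmil}}^t(\pi)=\{\sigma_i:z_i=t,\sigma_i<\sigma_j\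 \forall j<i\}$; ${\mathsf{Lmal}}^t(\pi)=\{\sigma_i:z_i=t,\sigma_i>\sigma_j\ \forall j<i\}$; ${\mathsf{Lmap}}^t(\pi)=\{i:z_i=t,\sigma_i>\sigma_j\ \forall j<i\}$; the colored versions ${\mathsf{Rmil}}(\pi)$ etc. are the sets of $x^{[t]}$ with $x$ in the $t$-refined set. For a sequence $a=(c_1^{[e_1]},\dots,c_n^{[e_n]})$: ${\mathsf{Max}}^t(a)=\{i:c_i=i,e_i=t\}$; ${\mathsf{Min}}^t(a)=\{i:c_i=1,e_i=t\}$; ${\mathsf{Rmil}}^t(a)=\{c_i:e_i=t,\ c_i<c_j\ \forall j>i\}$; ${\mathsf{Rmip}}^t(a)=\{i:e_i=t,\ c_i<c_j\ \forall j>i\}$; colored versions analogously. -}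

module Defs where

open import Data.Nat using (ℕ; suc)
import Data.Nat as ℕ
open import Data.Fin using (Fin; toℕ; _<_; _≤?_)
open import Data.Fin.Permutation using (Permutation′; _⟨$⟩ʳ_; _⟨$⟩ˡ_)
open import Data.List using (length; filter)
open import Data.List.Base using ()
open import Data.Fin.Base using ()
open import Data.List using (List)
open import Data.Fin.Properties using ()
open import Data.Product using (Σ; ∃; _×_; _,_; proj₁; proj₂)
open import Relation.Nullary.Decidable using (_×-dec_)
open import Relation.Binary.PropositionalEquality using (_≡_)
import Data.List as L
open import Data.Fin using () renaming (zero to fzero)

allFin : (n : ℕ) → List (Fin n)
allFin n = L.tabulate (λ i → i)

-- An element of G_{r,n}: π(i^[c]) = σ_i^[z_i + c].  Its window is
-- σ_1^[z_1] ... σ_n^[z_n].  Positions/values are Fin n (0-based internally);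
-- every set below is a subset of ℕ using the paper's 1-based labels,
-- i.e. the element k : Fin n is labelled suc (toℕ k).
record G (r n : ℕ) : Set where
  field
    σ : Permutation′ n
    z : Fin n → Fin r

Seq : ℕ → ℕ → Set
Seq r n = Fin n → ℕ × Fin r

lbl : {n : ℕ} → Fin n → ℕ
lbl k = suc (toℕ k)

module _ {r n : ℕ} (π : G r n) where
  open G π

  sw : Fin n → Fin n
  sw i = σ ⟨$⟩ʳ i

  sinv : Fin n → Fin n
  sinv i = σ ⟨$⟩ˡ i

  codeC : Fin n → ℕ
  codeC i = length (filter (λ j → (j ≤? i) ×-dec (sinv j ≤? sinv i)) (allFin n))

  codeE : Fin n → Fin r
  codeE i = z (sinv i)

  A-code : Seq r n
  A-code i = codeC i , codeE i

  Rmilπ : Fin r → ℕ → Set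
  Rmilπ t x = ∃ λ i → x ≡ lbl (sw i) × z i ≡ t × (∀ j → i < j → sw i < sw j)

  Lmilπ : Fin r → ℕ → Set
  Lmilπ t x = ∃ λ i → x ≡ lbl (sw i) × z i ≡ t × (∀ j → j < i → sw i < sw j)

  Lmalπ : Fin r → ℕ → Set
  Lmalπ t x = ∃ λ i → x ≡ lbl (sw i) × z i ≡ t × (∀ j → j < i → sw j < sw i)

  Lmapπ : Fin r → ℕ → Set
  Lmapπ t x = ∃ λ i → x ≡ lbl i × z i ≡ t × (∀ j → j < i → sw j < sw i)

module _ {r n : ℕ} (a : Seq r n) where
  private
    c : Fin n → ℕ
    c i = proj₁ (a i)
    e : Fin n → Fin r
    e i = proj₂ (a i)

  MaxS : Fin r → ℕ → Set
  MaxS t x = ∃ λ i → x ≡ lbl i × c i ≡ lbl i × e i ≡ t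

  MinS : Fin r → ℕ → Set
  MinS t x = ∃ λ i → x ≡ lbl i × c i ≡ 1 × e i ≡ t

  RmilS : Fin r → ℕ → Set
  RmilS t x = ∃ λ i → x ≡ c i × e i ≡ t × (∀ j → i < j → c i ℕ.< c j)

  RmipS : Fin r → ℕ → Set
  RmipS t x = ∃ λ i → x ≡ lbl i × e i ≡ t × (∀ j → i < j → c i ℕ.< c j)

_≐_ : {A : Set} → (A → Set) → (A → Set) → Set
P ≐ Q = ∀ x → (P x → Q x) × (Q x → P x)

-- colored version of a color-refined set: { x^[t] : x ∈ S^t }
Colored : {r : ℕ} → (Fin r → ℕ → Set) → ℕ × Fin r → Set
Colored S (x , t) = S t x

-- Read the window of π as the points (i , σᵢ) and let position = σ⁻¹.  The code c_v of a value v
-- counts the values u dominated by v, i.e. with u ≤ v and position u ≤ position v (v included).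
-- The dominated values always lie among the v values ≤ v, among the values at positions
-- ≤ position v, and include v itself; c_v attains these bounds exactly when v is a right-to-left
-- minimum (c_v = v), a left-to-right maximum (c_v = position v) and a left-to-right minimum
-- (c_v = 1) respectively.  Finally, left-to-right maxima are exactly the values whose code is
-- smaller than that of every larger value: larger values dominate strictly more, and conversely a
-- smallest larger value occurring earlier would have a code that is not larger.  Colours ride
-- along, since e_{σᵢ} = zᵢ.

module Submission where

open import Defs
open import Data.Nat as ℕ using (ℕ; zero; suc; s≤s; s≤s⁻¹)
import Data.Nat.Properties as ℕ
open import Data.Fin using (Fin; toℕ; fromℕ<; _≤_; _<_; _≤?_; _≟_)
open import Data.Fin.Properties using (toℕ-injective; toℕ-fromℕ<; toℕ<n; ≤-refl; <⇒≢; ≤∧≢⇒<)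
open import Data.Fin.Permutation as Permutation
  using (Permutation′; _⟨$⟩ʳ_; _⟨$⟩ˡ_; inverseˡ; inverseʳ)
open import Data.Fin.Induction using (<-wellFounded)
open import Induction.WellFounded using (Acc; acc)
open import Data.List using (List; _∷_; length; filter)
open import Data.List.Properties using (filter-accept; filter-reject; filter-none; filter-≐)
open import Data.List.Membership.Propositional using (_∈_)
open import Data.List.Membership.Propositional.Properties using (∈-filter⁺; ∈-filter⁻; ∈-allFin)
open import Data.List.Relation.Unary.Any using (here; there)
open import Data.List.Relation.Unary.All as All using (All; []; _∷_)
open import Data.List.Relation.Unary.AllPairs using (_∷_)
open import Data.List.Relation.Unary.Unique.Propositional using (Unique)
open import Data.List.Relation.Unary.Unique.Propositional.Properties using (allFin⁺)
open import Data.List.Relation.Binary.Pointwise using (Pointwise-≡⇒≡)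
open import Data.List.Relation.Binary.Sublist.Propositional using (⊆-refl) renaming (_⊆_ to _⊑_)
open import Data.List.Relation.Binary.Sublist.Heterogeneous.Properties
  using (length-mono-≤; toPointwise; ⊆-filter-Sublist)
open import Data.Product using (∃; _×_; _,_; proj₁; proj₂)
open import Data.Sum using (_⊎_; inj₁; inj₂)
open import Data.Empty using (⊥)
open import Function using (_∘_; _⇔_; mk⇔; Equivalence)
open import Level using (0ℓ)
open import Relation.Nullary using (¬_; Dec; yes; no; contradiction; _×-dec_)
open import Relation.Unary using (Pred; Decidable; _⊆_; _∩_; ∁; ｛_｝)
open import Relation.Unary.Properties using (_∩?_; ∁?)
open import Relation.Binary using (DecidableEquality)
open import Relation.Binary.PropositionalEquality
  using (_≡_; _≢_; refl; sym; trans; cong; subst; subst₂; module ≡-Reasoning)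

count : {A : Set} {P : Pred A 0ℓ} → Decidable P → List A → ℕ
count P? xs = length (filter P? xs)

module _ {A : Set} {P : Pred A 0ℓ} (P? : Decidable P) {x : A} {xs : List A} where

  count-accept : P x → count P? (x ∷ xs) ≡ suc (count P? xs)
  count-accept Px = cong length (filter-accept P? Px)

  count-reject : ¬ P x → count P? (x ∷ xs) ≡ count P? xs
  count-reject ¬Px = cong length (filter-reject P? ¬Px)

count-none : {A : Set} {P : Pred A 0ℓ} (P? : Decidable P) (xs : List A) → (∀ x → ¬ P x) → count P? xs ≡ 0
count-none P? xs ¬P = cong length (filter-none P? (All.universal ¬P xs))

module _ {A : Set} {P Q : Pred A 0ℓ} (P? : Decidable P) (Q? : Decidable Q) (xs : List A) where

  count-≐ : P ⊆ Q → Q ⊆ P → count P? xs ≡ count Q? xs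
  count-≐ P⊆Q Q⊆P = cong length (filter-≐ P? Q? (P⊆Q , Q⊆P) xs)

  filter-⊑ : P ⊆ Q → filter P? xs ⊑ filter Q? xs
  filter-⊑ P⊆Q = ⊆-filter-Sublist P? Q? (λ { refl → P⊆Q }) (⊆-refl {x = xs})

  count-mono : P ⊆ Q → count P? xs ℕ.≤ count Q? xs
  count-mono P⊆Q = length-mono-≤ (filter-⊑ P⊆Q)

  count-≡⇒⊇ : P ⊆ Q → count P? xs ≡ count Q? xs → ∀ {x} → x ∈ xs → Q x → P x
  count-≡⇒⊇ P⊆Q eq x∈xs Qx =
    proj₂ (∈-filter⁻ P? {xs = xs} (subst (_ ∈_) (sym filters-equal) (∈-filter⁺ Q? x∈xs Qx)))
    where
    filters-equal : filter P? xs ≡ filter Q? xs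
    filters-equal = Pointwise-≡⇒≡ (toPointwise eq (filter-⊑ P⊆Q))

  count-strict : P ⊆ Q → ∀ {x} → x ∈ xs → Q x → ¬ P x → count P? xs ℕ.< count Q? xs
  count-strict P⊆Q x∈xs Qx ¬Px =
    ℕ.≤∧≢⇒< (count-mono P⊆Q) (λ eq → ¬Px (count-≡⇒⊇ P⊆Q eq x∈xs Qx))

module Removal {A : Set} (_≟_ : DecidableEquality A) where
  open ≡-Reasoning

  _∖?_ : {P : Pred A 0ℓ} → Decidable P → (x : A) → Decidable (P ∩ ∁ ｛ x ｝)
  P? ∖? x = P? ∩? ∁? (x ≟_)

  module _ {P : Pred A 0ℓ} (P? : Decidable P) where

    count-∖-∉ : ∀ {x xs} → All (∁ ｛ x ｝) xs → count (P? ∖? x) xs ≡ count P? xs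
    count-∖-∉ [] = refl
    count-∖-∉ {x} {y ∷ xs} (x≢y ∷ x∉xs) = by-cases (P? y)
      where
      by-cases : Dec (P y) → count (P? ∖? x) (y ∷ xs) ≡ count P? (y ∷ xs)
      by-cases (yes Py) = begin
        count (P? ∖? x) (y ∷ xs) ≡⟨ count-accept (P? ∖? x) (Py , x≢y) ⟩
        suc (count (P? ∖? x) xs) ≡⟨ cong suc (count-∖-∉ x∉xs) ⟩
        suc (count P? xs)        ≡⟨ count-accept P? Py ⟨
        count P? (y ∷ xs)        ∎
      by-cases (no ¬Py) = begin
        count (P? ∖? x) (y ∷ xs) ≡⟨ count-reject (P? ∖? x) (¬Py ∘ proj₁) ⟩
        count (P? ∖? x) xs       ≡⟨ count-∖-∉ x∉xs ⟩
        count P? xs              ≡⟨ count-reject P? ¬Py ⟨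
        count P? (y ∷ xs)        ∎

    count-remove : ∀ {x xs} → Unique xs → x ∈ xs → P x → count P? xs ≡ suc (count (P? ∖? x) xs)
    count-remove {x} {.x ∷ xs} (x∉xs ∷ _) (here refl) Px = begin
      count P? (x ∷ xs)              ≡⟨ count-accept P? Px ⟩
      suc (count P? xs)              ≡⟨ cong suc (count-∖-∉ x∉xs) ⟨
      suc (count (P? ∖? x) xs)       ≡⟨ cong suc (count-reject (P? ∖? x) (λ (_ , x≢x) → x≢x refl)) ⟨
      suc (count (P? ∖? x) (x ∷ xs)) ∎
    count-remove {x} {y ∷ xs} (y∉xs ∷ unique) (there x∈xs) Px = by-cases (P? y)
      where
      y≢x : y ≢ x
      y≢x = All.lookup y∉xs x∈xs
      by-cases : Dec (P y) → count P? (y ∷ xs) ≡ suc (count (P? ∖? x) (y ∷ xs))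
      by-cases (yes Py) = begin
        count P? (y ∷ xs)              ≡⟨ count-accept P? Py ⟩
        suc (count P? xs)              ≡⟨ cong suc (count-remove unique x∈xs Px) ⟩
        suc (suc (count (P? ∖? x) xs)) ≡⟨ cong suc (count-accept (P? ∖? x) (Py , y≢x ∘ sym)) ⟨
        suc (count (P? ∖? x) (y ∷ xs)) ∎
      by-cases (no ¬Py) = begin
        count P? (y ∷ xs)              ≡⟨ count-reject P? ¬Py ⟩
        count P? xs                    ≡⟨ count-remove unique x∈xs Px ⟩
        suc (count (P? ∖? x) xs)       ≡⟨ cong suc (count-reject (P? ∖? x) (¬Py ∘ proj₁)) ⟨
        suc (count (P? ∖? x) (y ∷ xs)) ∎

  count-singleton : ∀ {x xs} → Unique xs → x ∈ xs → count (x ≟_) xs ≡ 1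
  count-singleton {x} {xs} unique x∈xs =
    trans (count-remove (x ≟_) unique x∈xs refl)
          (cong suc (count-none ((x ≟_) ∖? x) xs (λ _ (x≡y , x≢y) → x≢y x≡y)))

open module FinRemoval {n : ℕ} = Removal (_≟_ {n})

module _ {n : ℕ} (ρ : Permutation′ n) where

  count-<-perm : ∀ k → k ℕ.≤ n → count (λ u → toℕ (ρ ⟨$⟩ʳ u) ℕ.<? k) (allFin n) ≡ k
  count-<-perm zero _ = count-none _ (allFin n) (λ _ ())
  count-<-perm (suc k) k<n = begin
    count (<? suc k) (allFin n)
      ≡⟨ count-remove (<? suc k) (allFin⁺ n) (∈-allFin x) ρx<1+k ⟩
    suc (count ((<? suc k) ∖? x) (allFin n))
      ≡⟨ cong suc (count-≐ ((<? suc k) ∖? x) (<? k) (allFin n) below below⁻¹) ⟩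
    suc (count (<? k) (allFin n))
      ≡⟨ cong suc (count-<-perm k (ℕ.<⇒≤ k<n)) ⟩
    suc k
      ∎
    where
    open ≡-Reasoning
    <?_ : ∀ m → Decidable (λ u → toℕ (ρ ⟨$⟩ʳ u) ℕ.< m)
    (<? m) u = toℕ (ρ ⟨$⟩ʳ u) ℕ.<? m
    x : Fin n
    x = ρ ⟨$⟩ˡ fromℕ< k<n
    ρx≡k : toℕ (ρ ⟨$⟩ʳ x) ≡ k
    ρx≡k = trans (cong toℕ (inverseʳ ρ)) (toℕ-fromℕ< k<n)
    ρx<1+k : toℕ (ρ ⟨$⟩ʳ x) ℕ.< suc k
    ρx<1+k = ℕ.≤-reflexive (cong suc ρx≡k)
    ρ≡k⇒x≡ : ∀ {u} → toℕ (ρ ⟨$⟩ʳ u) ≡ k → x ≡ u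
    ρ≡k⇒x≡ {u} eq = begin
      ρ ⟨$⟩ˡ fromℕ< k<n ≡⟨ cong (ρ ⟨$⟩ˡ_) (toℕ-injective (trans (toℕ-fromℕ< k<n) (sym eq))) ⟩
      ρ ⟨$⟩ˡ (ρ ⟨$⟩ʳ u) ≡⟨ inverseˡ ρ ⟩
      u                 ∎
    below : ∀ {u} → toℕ (ρ ⟨$⟩ʳ u) ℕ.< suc k × x ≢ u → toℕ (ρ ⟨$⟩ʳ u) ℕ.< k
    below (lt , x≢u) = ℕ.≤∧≢⇒< (s≤s⁻¹ lt) (x≢u ∘ ρ≡k⇒x≡)
    below⁻¹ : ∀ {u} → toℕ (ρ ⟨$⟩ʳ u) ℕ.< k → toℕ (ρ ⟨$⟩ʳ u) ℕ.< suc k × x ≢ u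
    below⁻¹ lt = ℕ.m<n⇒m<1+n lt , λ { refl → ℕ.<-irrefl ρx≡k lt }

  count-≤-perm : (p : Fin n) → count (λ u → ρ ⟨$⟩ʳ u ≤? p) (allFin n) ≡ suc (toℕ p)
  count-≤-perm p = trans
    (count-≐ _ (λ u → toℕ (ρ ⟨$⟩ʳ u) ℕ.<? suc (toℕ p)) (allFin n) s≤s s≤s⁻¹)
    (count-<-perm (suc (toℕ p)) (toℕ<n p))

≤⇒<⊎≡ : ∀ {n} {i j : Fin n} → i ≤ j → i < j ⊎ i ≡ j
≤⇒<⊎≡ i≤j with ℕ.m≤n⇒m<n∨m≡n i≤j
... | inj₁ i<j = inj₁ i<j
... | inj₂ i≡j = inj₂ (toℕ-injective i≡j)

module Dominance {n : ℕ} (σ : Permutation′ n) where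

  value : Fin n → Fin n
  value i = σ ⟨$⟩ʳ i

  position : Fin n → Fin n
  position v = σ ⟨$⟩ˡ v

  position-value : ∀ {i} → position (value i) ≡ i
  position-value = inverseˡ σ

  value-position : ∀ {v} → value (position v) ≡ v
  value-position = inverseʳ σ

  value-injective : ∀ {i j} → value i ≡ value j → i ≡ j
  value-injective eq = trans (sym position-value) (trans (cong position eq) position-value)

  position-≤-split : ∀ {u i} → position u ≤ i → position u < i ⊎ u ≡ value i
  position-≤-split pu≤i with ≤⇒<⊎≡ pu≤i
  ... | inj₁ pu<i = inj₁ pu<i
  ... | inj₂ pu≡i = inj₂ (trans (sym value-position) (cong value pu≡i))

  ∃-reindex : {A B : Fin n → Set} → (∀ i → A i ⇔ B (value i)) → ∃ A ⇔ ∃ B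
  ∃-reindex {A} {B} A⇔B = mk⇔
    (λ (i , a) → value i , Equivalence.to (A⇔B i) a)
    (λ (v , b) → position v , Equivalence.from (A⇔B (position v)) (subst B (sym value-position) b))

  Dominated : Fin n → Pred (Fin n) 0ℓ
  Dominated v u = u ≤ v × position u ≤ position v

  dominated? : (v : Fin n) → Decidable (Dominated v)
  dominated? v u = (u ≤? v) ×-dec (position u ≤? position v)

  -- Definitionally the first component codeC of the A-code.
  code : Fin n → ℕ
  code v = count (dominated? v) (allFin n)

  RightToLeftMinimum LeftToRightMinimum LeftToRightMaximum LargerValuesLater : Fin n → Set
  RightToLeftMinimum i = ∀ j → i < j → value i < value j
  LeftToRightMinimum i = ∀ j → j < i → value i < value j
  LeftToRightMaximum i = ∀ j → j < i → value j < value i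
  LargerValuesLater  i = ∀ u → value i < u → i < position u

  CodeRightToLeftMinimum : Fin n → Set
  CodeRightToLeftMinimum v = ∀ w → v < w → code v ℕ.< code w

  module _ {i : Fin n} where

    RightToLeftMinimum⇔code≡lbl : RightToLeftMinimum i ⇔ code (value i) ≡ lbl (value i)
    RightToLeftMinimum⇔code≡lbl = mk⇔
      (λ minimal → trans (count-≐ (dominated? (value i)) (_≤? value i) (allFin n)
                                   proj₁ (smaller-dominated minimal))
                         count-smaller)
      (λ code≡ → smaller-dominated⁻¹ (count-≡⇒⊇ (dominated? (value i)) (_≤? value i) (allFin n)
                                         proj₁ (trans code≡ (sym count-smaller)) (∈-allFin _)))
      where
      count-smaller : count (_≤? value i) (allFin n) ≡ lbl (value i)
      count-smaller = count-≤-perm Permutation.id (value i)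
      smaller-dominated : RightToLeftMinimum i → (_≤ value i) ⊆ Dominated (value i)
      smaller-dominated minimal {u} u≤vi = u≤vi , subst (position u ≤_) (sym position-value)
        (ℕ.≮⇒≥ λ i<pu → ℕ.<⇒≱ (subst (value i <_) value-position (minimal _ i<pu)) u≤vi)
      smaller-dominated⁻¹ : (_≤ value i) ⊆ Dominated (value i) → RightToLeftMinimum i
      smaller-dominated⁻¹ dominated j i<j = ℕ.≰⇒> λ vj≤vi →
        ℕ.<⇒≱ i<j (subst₂ _≤_ position-value position-value (proj₂ (dominated vj≤vi)))

    LeftToRightMinimum⇔code≡1 : LeftToRightMinimum i ⇔ code (value i) ≡ 1
    LeftToRightMinimum⇔code≡1 = mk⇔
      (λ minimal → trans (count-≐ (dominated? (value i)) (value i ≟_) (allFin n)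
                                   (only-self-dominated minimal) self-dominated)
                         count-self)
      (λ code≡1 → only-self-dominated⁻¹ (count-≡⇒⊇ (value i ≟_) (dominated? (value i)) (allFin n)
                                           self-dominated (trans count-self (sym code≡1)) (∈-allFin _)))
      where
      count-self : count (value i ≟_) (allFin n) ≡ 1
      count-self = count-singleton (allFin⁺ n) (∈-allFin (value i))
      self-dominated : ｛ value i ｝ ⊆ Dominated (value i)
      self-dominated refl = ≤-refl , ≤-refl
      only-self-dominated : LeftToRightMinimum i → Dominated (value i) ⊆ ｛ value i ｝
      only-self-dominated minimal {u} (u≤vi , pu≤pvi)
        with position-≤-split (subst (position u ≤_) position-value pu≤pvi)
      ... | inj₁ pu<i = contradiction u≤vi (ℕ.<⇒≱ (subst (value i <_) value-position (minimal _ pu<i)))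
      ... | inj₂ u≡vi = sym u≡vi
      only-self-dominated⁻¹ : Dominated (value i) ⊆ ｛ value i ｝ → LeftToRightMinimum i
      only-self-dominated⁻¹ only-self j j<i = ℕ.≰⇒> λ vj≤vi →
        <⇒≢ j<i (value-injective (sym (only-self (vj≤vi , pvj≤pvi))))
        where
        pvj≤pvi : position (value j) ≤ position (value i)
        pvj≤pvi = subst₂ _≤_ (sym position-value) (sym position-value) (ℕ.<⇒≤ j<i)

    LeftToRightMaximum⇔LargerValuesLater : LeftToRightMaximum i ⇔ LargerValuesLater i
    LeftToRightMaximum⇔LargerValuesLater = mk⇔ to from
      where
      to : LeftToRightMaximum i → LargerValuesLater i
      to maximal u vi<u = ℕ.≰⇒> λ pu≤i → case (position-≤-split pu≤i)
        where
        case : position u < i ⊎ u ≡ value i → ⊥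
        case (inj₁ pu<i) = ℕ.<-asym (subst (_< value i) value-position (maximal _ pu<i)) vi<u
        case (inj₂ refl) = ℕ.<-irrefl refl vi<u
      from : LargerValuesLater i → LeftToRightMaximum i
      from later j j<i = ℕ.≰⇒> λ vi≤vj → case (≤⇒<⊎≡ vi≤vj)
        where
        case : value i < value j ⊎ value i ≡ value j → ⊥
        case (inj₁ vi<vj) = ℕ.<-asym j<i (subst (i <_) position-value (later _ vi<vj))
        case (inj₂ vi≡vj) = <⇒≢ j<i (sym (value-injective vi≡vj))

    LargerValuesLater⇒code≡lbl : LargerValuesLater i → code (value i) ≡ lbl i
    LargerValuesLater⇒code≡lbl later = begin
      code (value i)
        ≡⟨ count-≐ (dominated? (value i)) earlier? (allFin n) proj₂ earlier-dominated ⟩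
      count earlier? (allFin n)
        ≡⟨ count-≤-perm (Permutation.flip σ) (position (value i)) ⟩
      lbl (position (value i))
        ≡⟨ cong lbl position-value ⟩
      lbl i
        ∎
      where
      open ≡-Reasoning
      earlier? : Decidable (λ u → position u ≤ position (value i))
      earlier? u = position u ≤? position (value i)
      earlier-dominated : ∀ {u} → position u ≤ position (value i) → Dominated (value i) u
      earlier-dominated {u} pu≤pvi =
        ℕ.≮⇒≥ (λ vi<u → ℕ.<⇒≱ (later u vi<u) (subst (position u ≤_) position-value pu≤pvi)) ,
        pu≤pvi

    LargerValuesLater⇒CodeRightToLeftMinimum : LargerValuesLater i → CodeRightToLeftMinimum (value i)
    LargerValuesLater⇒CodeRightToLeftMinimum later w vi<w =
      count-strict (dominated? (value i)) (dominated? w) (allFin n) dominated-mono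
                   (∈-allFin w) (≤-refl , ≤-refl) (λ (w≤vi , _) → ℕ.<⇒≱ vi<w w≤vi)
      where
      dominated-mono : Dominated (value i) ⊆ Dominated w
      dominated-mono (u≤vi , pu≤pvi) =
        ℕ.≤-trans u≤vi (ℕ.<⇒≤ vi<w) ,
        ℕ.≤-trans pu≤pvi (subst (_≤ position w) (sym position-value) (ℕ.<⇒≤ (later w vi<w)))

    -- If some u > value i occurs before i, take the least one: every other value that u dominates
    -- is then also dominated by value i, so code u ≤ code (value i).
    CodeRightToLeftMinimum⇒LargerValuesLater : CodeRightToLeftMinimum (value i) → LargerValuesLater i
    CodeRightToLeftMinimum⇒LargerValuesLater increasing u = go u (<-wellFounded u)
      where
      go : ∀ u → Acc _<_ u → value i < u → i < position u
      go u (acc smaller) vi<u = ℕ.≰⇒> λ pu≤i → ℕ.<⇒≱ (increasing u vi<u) (code-≤ (earlier pu≤i))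
        where
        earlier : position u ≤ i → position u < i
        earlier pu≤i with position-≤-split pu≤i
        ... | inj₁ pu<i = pu<i
        ... | inj₂ refl = contradiction vi<u (ℕ.<-irrefl refl)
        shift : position u < i → Dominated u ∩ ∁ ｛ u ｝ ⊆ Dominated (value i) ∩ ∁ ｛ value i ｝
        shift pu<i {y} ((y≤u , py≤pu) , u≢y) = (y≤vi , ℕ.<⇒≤ py<pvi) , vi≢y
          where
          py<i : position y < i
          py<i = ℕ.≤-<-trans py≤pu pu<i
          py<pvi : position y < position (value i)
          py<pvi = subst (position y <_) (sym position-value) py<i
          y≤vi : y ≤ value i
          y≤vi = ℕ.≮⇒≥ λ vi<y →
            ℕ.<⇒≱ (go y (smaller (≤∧≢⇒< y≤u (u≢y ∘ sym))) vi<y) (ℕ.<⇒≤ py<i)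
          vi≢y : value i ≢ y
          vi≢y refl = ℕ.<-irrefl (cong toℕ position-value) py<i
        code-≤ : position u < i → code u ℕ.≤ code (value i)
        code-≤ pu<i = subst₂ ℕ._≤_
          (sym (count-remove (dominated? u) (allFin⁺ n) (∈-allFin u) (≤-refl , ≤-refl)))
          (sym (count-remove (dominated? (value i)) (allFin⁺ n) (∈-allFin (value i)) (≤-refl , ≤-refl)))
          (s≤s (count-mono (dominated? u ∖? u) (dominated? (value i) ∖? value i) (allFin n) (shift pu<i)))

⇔⇒≐ : {A : Set} {P Q : A → Set} → (∀ x → P x ⇔ Q x) → P ≐ Q
⇔⇒≐ P⇔Q x = Equivalence.to (P⇔Q x) , Equivalence.from (P⇔Q x)

Colored-≐ : {r : ℕ} {S S′ : Fin r → ℕ → Set} → (∀ t → S t ≐ S′ t) → Colored S ≐ Colored S′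
Colored-≐ S≐S′ (x , t) = S≐S′ t x

module _ {r n : ℕ} (π : G r n) (t : Fin r) where
  open G π
  open Dominance σ
  open Equivalence

  private
    color : ∀ {i} → z i ≡ t → codeE π (value i) ≡ t
    color = trans (cong z position-value)

    color⁻¹ : ∀ {i} → codeE π (value i) ≡ t → z i ≡ t
    color⁻¹ = trans (cong z (sym position-value))

  Rmil≐Max : Rmilπ π t ≐ MaxS (A-code π) t
  Rmil≐Max = ⇔⇒≐ λ x → ∃-reindex λ i → mk⇔
    (λ (x≡ , zi≡t , minimal) → x≡ , to RightToLeftMinimum⇔code≡lbl minimal , color zi≡t)
    (λ (x≡ , code≡ , e≡t) → x≡ , color⁻¹ e≡t , from RightToLeftMinimum⇔code≡lbl code≡)

  Lmil≐Min : Lmilπ π t ≐ MinS (A-code π) t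
  Lmil≐Min = ⇔⇒≐ λ x → ∃-reindex λ i → mk⇔
    (λ (x≡ , zi≡t , minimal) → x≡ , to LeftToRightMinimum⇔code≡1 minimal , color zi≡t)
    (λ (x≡ , code≡ , e≡t) → x≡ , color⁻¹ e≡t , from LeftToRightMinimum⇔code≡1 code≡)

  Lmap≐Rmil : Lmapπ π t ≐ RmilS (A-code π) t
  Lmap≐Rmil = ⇔⇒≐ λ x → ∃-reindex λ i → mk⇔
    (λ (x≡ , zi≡t , maximal) → let later = to LeftToRightMaximum⇔LargerValuesLater maximal in
      trans x≡ (sym (LargerValuesLater⇒code≡lbl later)) , color zi≡t ,
      LargerValuesLater⇒CodeRightToLeftMinimum later)
    (λ (x≡ , e≡t , increasing) → let later = CodeRightToLeftMinimum⇒LargerValuesLater increasing in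
      trans x≡ (LargerValuesLater⇒code≡lbl later) , color⁻¹ e≡t ,
      from LeftToRightMaximum⇔LargerValuesLater later)

  Lmal≐Rmip : Lmalπ π t ≐ RmipS (A-code π) t
  Lmal≐Rmip = ⇔⇒≐ λ x → ∃-reindex λ i → mk⇔
    (λ (x≡ , zi≡t , maximal) → x≡ , color zi≡t ,
      LargerValuesLater⇒CodeRightToLeftMinimum (to LeftToRightMaximum⇔LargerValuesLater maximal))
    (λ (x≡ , e≡t , increasing) → x≡ , color⁻¹ e≡t ,
      from LeftToRightMaximum⇔LargerValuesLater (CodeRightToLeftMinimum⇒LargerValuesLater increasing))

lemma3p2 : ∀ {r n : ℕ} (π : G r n) →
    ((t : Fin r) →
        (Rmilπ π t ≐ MaxS (A-code π) t)
      × (Lmilπ π t ≐ MinS (A-code π) t)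
      × (Lmapπ π t ≐ RmilS (A-code π) t)
      × (Lmalπ π t ≐ RmipS (A-code π) t))
    × (Colored (Rmilπ π) ≐ Colored (MaxS (A-code π)))
    × (Colored (Lmilπ π) ≐ Colored (MinS (A-code π)))
    × (Colored (Lmapπ π) ≐ Colored (RmilS (A-code π)))
    × (Colored (Lmalπ π) ≐ Colored (RmipS (A-code π)))
lemma3p2 π =
    (λ t → Rmil≐Max π t , Lmil≐Min π t , Lmap≐Rmil π t , Lmal≐Rmip π t)
  , Colored-≐ (Rmil≐Max π) , Colored-≐ (Lmil≐Min π)
  , Colored-≐ (Lmap≐Rmil π) , Colored-≐ (Lmal≐Rmip π)
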